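{- For every integer $m\ge1$ and every edge $e\in E(G_m)$, the graph $G_m\setminus\{e\}$ is $2$-degenerate, hence $3$-colorable.
   Context: A graph is $2$-degenerate if every nonempty subgraph has a vertex of degree at most $2$. Fix $m\ge1$. Spine blocks $S_0,\dots,S_m$: each $S_i$ is a $5$-cycle with vertices $S_i[a],S_i[b],S_i[c],S_i[d],S_i[e]$ in this cyclic order. Leaf blocks: $L_{0,x}$ for $x\in\{a,b,d,e\}$; $L_{i,x}$ for $1\le i\le m-1$ and $x\in\{b,d,e\}$; $L_{m,x}$ for $x\in\{b,c,d,e\}$. Each $L_{i,x}$ is a $5$-cycle with vertices $L_{i,x}[A],\dots,L_{i,x}[E]$ in this cyclic order. All blocks are vertex-disjoint. For a lowercase letter $x$, $X$ denotes the corresponding uppercase letter. Add edges $S_i[x]L_{i,x}[X]$ for each leaf block $L_{i,x}$, and edges $S_i[c]S_{i+1}[a]$ for $0\le i<m$. Finally add a new vertex $v$ adjacent to the four vertices $L_{i,x}[Y]$, $Y\ne X$, of every leaf block $L_{i,x}$. The resulting graph is $G_m$. -}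

module Defs where

open import Data.Nat using (ℕ; zero; suc; _≤_; _≡ᵇ_)
open import Data.Bool using (Bool; true; false; _∧_; _∨_; not; if_then_else_; T)
open import Data.Fin using (Fin; toℕ)
open import Data.List using (List; length)
open import Data.List.Membership.Propositional using (_∈_)
open import Data.Product using (Σ; _×_; ∃)
open import Data.Sum using (_⊎_)
open import Relation.Binary.PropositionalEquality using (_≡_)
open import Relation.Nullary using (¬_)

record Graph : Set₁ where
  field
    V : Set
    Adj : V → V → Set
open Graph public

deleteEdge : (G : Graph) → V G → V G → Graph
deleteEdge G u v = record
  { V = V G
  ; Adj = λ x y → Adj G x y × ¬ ((x ≡ u × y ≡ v) ⊎ (x ≡ v × y ≡ u)) }

record Subgraph (G : Graph) : Set where
  field
    S : V G → Bool
    F : V G → V G → Bool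
    F⊆E : ∀ x y → T (F x y) → Adj G x y
    F⊆S : ∀ x y → T (F x y) → T (S x) × T (S y)
    Fsym : ∀ x y → T (F x y) → T (F y x)
open Subgraph public

DegAtMost2 : {G : Graph} → Subgraph G → V G → Set
DegAtMost2 {G} H x =
  Σ (List (V G)) λ ns → (length ns ≤ 2) × (∀ y → T (F H x y) → y ∈ ns)

TwoDegenerate : Graph → Set
TwoDegenerate G = (H : Subgraph G) → (∃ λ x → T (S H x)) →
  ∃ λ x → T (S H x) × DegAtMost2 H x

ThreeColorable : Graph → Set
ThreeColorable G = Σ (V G → Fin 3) λ c → ∀ x y → Adj G x y → ¬ (c x ≡ c y)

-- letters a..e; the uppercase letter X is represented by the same letter
data Letter : Set where
  a b c d e : Letter

_==L_ : Letter → Letter → Bool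
a ==L a = true
b ==L b = true
c ==L c = true
d ==L d = true
e ==L e = true
_ ==L _ = false

nextL : Letter → Letter
nextL a = b
nextL b = c
nextL c = d
nextL d = e
nextL e = a

-- isLeaf m i x = true iff the leaf block L_{i,x} exists (for m ≥ 1)
isLeaf : ℕ → ℕ → Letter → Bool
isLeaf m zero x = not (x ==L c)
isLeaf m (suc k) x =
  if suc k ≡ᵇ m then not (x ==L a)
  else not (x ==L a) ∧ not (x ==L c)

data Vtx (m : ℕ) : Set where
  spine : (i : Fin (suc m)) → (x : Letter) → Vtx m
  leaf  : (i : Fin (suc m)) → (x : Letter) → T (isLeaf m (toℕ i) x) → (Y : Letter) → Vtx m
  apex  : Vtx m

_==F_ : {n : ℕ} → Fin n → Fin n → Bool
i ==F j = toℕ i ≡ᵇ toℕ j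

arc : {m : ℕ} → Vtx m → Vtx m → Bool
arc (spine i x) (spine j y) =
  ((i ==F j) ∧ (y ==L nextL x))
  ∨ ((x ==L c) ∧ (y ==L a) ∧ (suc (toℕ i) ≡ᵇ toℕ j))
arc (spine i x) (leaf j y _ Y) = (i ==F j) ∧ (x ==L y) ∧ (Y ==L x)
arc (leaf i x _ Y) (leaf j y _ Z) =
  (i ==F j) ∧ (x ==L y) ∧ (Z ==L nextL Y)
arc apex (leaf i x _ Y) = not (Y ==L x)
arc _ _ = false

adj : {m : ℕ} → Vtx m → Vtx m → Bool
adj u w = arc u w ∨ arc w u

G : ℕ → Graph
G m = record { V = Vtx m ; Adj = λ u w → T (adj u w) }

module Submission where

open import Defs

open import Data.Bool using (true; false; not; T)
open import Data.Bool.Properties using (T-∧; T-∨; T-irrelevant; T?)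
open import Data.Empty using (⊥-elim)
open import Data.Fin using (Fin; toℕ; inject₁) renaming (zero to fzero; suc to fsuc)
open import Data.Fin.Induction using (<-weakInduction)
open import Data.Fin.Properties using (toℕ-injective; toℕ-inject₁; toℕ<n) renaming (_≟_ to _≟F_)
open import Data.List using (List; []; _∷_; length; map; concatMap; filter; allFin)
open import Data.List.Membership.Propositional using (_∈_; find; lose)
open import Data.List.Membership.Propositional.Properties using (∈-map⁺; ∈-concat⁺′; ∈-filter⁺; ∈-allFin)
import Data.List.Membership.DecPropositional as DecMembership
open import Data.List.Properties using (filter-notAll)
open import Data.List.Relation.Unary.All using (lookup; all?)
open import Data.List.Relation.Unary.All.Properties using (¬All⇒Any¬)
open import Data.List.Relation.Unary.Any using (here; there; any?)
open import Data.Nat using (ℕ; suc; _≤_; z≤n; s≤s; _≡ᵇ_)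
open import Data.Nat.Properties using (≡ᵇ⇒≡; ≡⇒≡ᵇ; suc-injective; <-irrefl; ≤-refl; ≤-pred; <-≤-trans)
open import Data.Product using (Σ; ∃; ∃₂; _×_; _,_; proj₁; proj₂)
import Data.Product as Product
open import Data.Sum using (_⊎_; inj₁; inj₂)
import Data.Sum as Sum
open import Function.Bundles using (module Equivalence)
open import Relation.Binary.Definitions using (DecidableEquality)
open import Relation.Binary.PropositionalEquality using (_≡_; _≢_; refl; sym; trans; cong; cong₂; subst)
open import Relation.Nullary using (¬_; Dec; yes; no)
open import Relation.Nullary.Decidable using (_×-dec_; _⊎-dec_; ¬?; ⌊_⌋; map′; toWitness; fromWitness)

open Equivalence using (to; from)

-- Every vertex of G_m other than the apex v has degree at most 3, and G_m − v is connected.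
-- Let H be a nonempty subgraph of G_m − e. If v is the only vertex of H, it is isolated in H.
-- Otherwise, if every vertex of H other than v had degree ≥ 3 in H, each would keep all its
-- G_m-edges in H, so by connectivity H would contain the endpoint s ≠ v of e with all its edges;
-- but s has lost e. Hence H has a vertex of degree ≤ 2, and removing such vertices one at a
-- time and colouring them back greedily gives a 3-colouring.

DegreeAtMost : (G : Graph) → ℕ → V G → Set
DegreeAtMost G k x = Σ (List (V G)) λ ns → (length ns ≤ k) × (∀ y → Adj G x y → y ∈ ns)

LowVertex : {G : Graph} → Subgraph G → Set
LowVertex H = ∃ λ x → T (S H x) × DegAtMost2 H x

record IsFiniteSimple (G : Graph) : Set where
  field
    _≟_        : DecidableEquality (V G)
    adj?       : ∀ x y → Dec (Adj G x y)
    adj-sym    : ∀ {x y} → Adj G x y → Adj G y x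
    adj-irrefl : ∀ {x} → ¬ Adj G x x
    vertices   : List (V G)
    ∈-vertices : ∀ x → x ∈ vertices

deleteEdge-isFiniteSimple : ∀ {G} → IsFiniteSimple G → ∀ u w → IsFiniteSimple (deleteEdge G u w)
deleteEdge-isFiniteSimple fin u w = record
  { _≟_        = _≟_
  ; adj?       = λ x y → adj? x y ×-dec ¬? ((x ≟ u ×-dec y ≟ w) ⊎-dec (x ≟ w ×-dec y ≟ u))
  ; adj-sym    = λ (xy , ¬uw) → adj-sym xy , λ uw → ¬uw (Sum.swap (Sum.map Product.swap Product.swap uw))
  ; adj-irrefl = λ (xx , _) → adj-irrefl xx
  ; vertices   = vertices
  ; ∈-vertices = ∈-vertices
  }
  where open IsFiniteSimple fin

liftSubgraph : ∀ {G u w} → Subgraph (deleteEdge G u w) → Subgraph G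
liftSubgraph H = record
  { S = S H ; F = F H ; F⊆E = λ x y f → proj₁ (F⊆E H x y f) ; F⊆S = F⊆S H ; Fsym = Fsym H }

∈-concatMap : ∀ {A B : Set} (f : A → List B) {x xs y} → x ∈ xs → y ∈ f x → y ∈ concatMap f xs
∈-concatMap f x∈xs y∈fx = ∈-concat⁺′ y∈fx (∈-map⁺ f x∈xs)

data Walk (G : Graph) (P : V G → Set) : V G → V G → Set where
  [_] : ∀ {x} → P x → Walk G P x x
  step : ∀ {x y z} → P x → Adj G x y → Walk G P y z → Walk G P x z

module _ {G : Graph} {P : V G → Set} where

  head : ∀ {x y} → Walk G P x y → P x
  head [ px ] = px
  head (step px _ _) = px

  _++ʷ_ : ∀ {x y z} → Walk G P x y → Walk G P y z → Walk G P x z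
  [ _ ] ++ʷ w′ = w′
  step px xy w ++ʷ w′ = step px xy (w ++ʷ w′)

  reverseʷ : (∀ {x y} → Adj G x y → Adj G y x) → ∀ {x y} → Walk G P x y → Walk G P y x
  reverseʷ symmetric [ px ] = [ px ]
  reverseʷ symmetric (step px xy w) = reverseʷ symmetric w ++ʷ step (head w) (symmetric xy) [ px ]

module _ {G : Graph} (fin : IsFiniteSimple G) where

  open IsFiniteSimple fin

  degree≤3 : ∀ x n₁ n₂ (Exit : V G → Set) →
    (∀ {y} → Adj G x y → y ≡ n₁ ⊎ y ≡ n₂ ⊎ Exit y) →
    (∀ {y y′} → Exit y → Exit y′ → y ≡ y′) →
    DegreeAtMost G 3 x
  degree≤3 x n₁ n₂ Exit classify unique
    with any? (λ y → adj? x y ×-dec ¬? (y ≟ n₁) ×-dec ¬? (y ≟ n₂)) vertices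
  ... | yes some = (n₁ ∷ n₂ ∷ o ∷ []) , s≤s (s≤s (s≤s z≤n)) , covers
    where
    exit : ∀ {y} → Adj G x y → y ≢ n₁ → y ≢ n₂ → Exit y
    exit xy y≢n₁ y≢n₂ with classify xy
    ... | inj₁ y≡n₁ = ⊥-elim (y≢n₁ y≡n₁)
    ... | inj₂ (inj₁ y≡n₂) = ⊥-elim (y≢n₂ y≡n₂)
    ... | inj₂ (inj₂ exit-y) = exit-y
    o = proj₁ (find some)
    o-exit = let xo , o≢n₁ , o≢n₂ = proj₂ (proj₂ (find some)) in exit xo o≢n₁ o≢n₂
    covers : ∀ y → Adj G x y → y ∈ n₁ ∷ n₂ ∷ o ∷ []
    covers y xy with y ≟ n₁ | y ≟ n₂
    ... | yes refl | _ = here refl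
    ... | no _ | yes refl = there (here refl)
    ... | no y≢n₁ | no y≢n₂ = there (there (here (unique (exit xy y≢n₁ y≢n₂) o-exit)))
  ... | no none = (n₁ ∷ n₂ ∷ []) , s≤s (s≤s z≤n) , covers
    where
    covers : ∀ y → Adj G x y → y ∈ n₁ ∷ n₂ ∷ []
    covers y xy with y ≟ n₁ | y ≟ n₂
    ... | yes refl | _ = here refl
    ... | no _ | yes refl = there (here refl)
    ... | no y≢n₁ | no y≢n₂ = ⊥-elim (none (lose (∈-vertices y) (xy , y≢n₁ , y≢n₂)))

  endpoint-avoiding : ∀ v {u w} → Adj G u w →
    ∃₂ λ s t → s ≢ v × Adj G s t × ((s ≡ u × t ≡ w) ⊎ (s ≡ w × t ≡ u))
  endpoint-avoiding v {u} {w} uw with u ≟ v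
  ... | no u≢v = u , w , u≢v , uw , inj₁ (refl , refl)
  ... | yes refl = w , v , (λ { refl → adj-irrefl uw }) , adj-sym uw , inj₂ (refl , refl)

module _ {G : Graph} (H : Subgraph G) where

  inH? : ∀ x y → Dec (T (F H x y))
  inH? x y = T? (F H x y)

  Saturated : V G → Set
  Saturated x = ∀ y → Adj G x y → T (F H x y)

  degAtMost2-or-saturated : ∀ {x} → DegreeAtMost G 3 x → DegAtMost2 H x ⊎ Saturated x
  degAtMost2-or-saturated {x} (ns , |ns|≤3 , ns-covers) with all? (inH? x) ns
  ... | yes all-inH = inj₂ λ y xy → lookup all-inH (ns-covers y xy)
  ... | no ¬all-inH = inj₁ (filter (inH? x) ns , ≤-pred (<-≤-trans shorter |ns|≤3) , covers)
    where
    shorter = filter-notAll (inH? x) ns (¬All⇒Any¬ (inH? x) ns ¬all-inH)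
    covers : ∀ y → T (F H x y) → y ∈ filter (inH? x) ns
    covers y f = ∈-filter⁺ (inH? x) (ns-covers y (F⊆E H x y f)) f

  saturation-spreads : ∀ {P} → (∀ x → P x → DegreeAtMost G 3 x) →
    ∀ {x y} → Walk G P x y → T (S H x) → LowVertex H ⊎ T (S H y)
  saturation-spreads subcubic [ _ ] sx = inj₂ sx
  saturation-spreads subcubic (step {x} px xy w) sx with degAtMost2-or-saturated (subcubic x px)
  ... | inj₁ low = inj₁ (x , sx , low)
  ... | inj₂ sat = saturation-spreads subcubic w (proj₂ (F⊆S H x _ (sat _ xy)))

module _ {G : Graph} (fin : IsFiniteSimple G) (H : Subgraph G) where

  open IsFiniteSimple fin

  low-or-member≢ : ∀ v x → T (S H x) → LowVertex H ⊎ ∃ λ z → z ≢ v × T (S H z)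
  low-or-member≢ v x sx with x ≟ v
  ... | no x≢v = inj₂ (x , x≢v , sx)
  ... | yes refl with any? (inH? H v) vertices
  ...   | no none = inj₁ (v , sx , [] , z≤n , λ y f → ⊥-elim (none (lose (∈-vertices y) f)))
  ...   | yes some = inj₂ (y , y≢v , proj₂ (F⊆S H v y f))
    where
    y = proj₁ (find some)
    f = proj₂ (proj₂ (find some))
    y≢v : y ≢ v
    y≢v y≡v = adj-irrefl (subst (Adj G v) y≡v (F⊆E H v y f))

deleteEdge-twoDegenerate : ∀ {G} → IsFiniteSimple G → ∀ v →
  (∀ x → x ≢ v → DegreeAtMost G 3 x) →
  (∀ x y → x ≢ v → y ≢ v → Walk G (_≢ v) x y) →
  ∀ {u w} → Adj G u w → TwoDegenerate (deleteEdge G u w)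
deleteEdge-twoDegenerate fin v subcubic connected uw H (x , sx)
  with low-or-member≢ fin (liftSubgraph H) v x sx
... | inj₁ low = low
... | inj₂ (z , z≢v , sz) with endpoint-avoiding fin v uw
... | s , t , s≢v , st , deleted
  with saturation-spreads (liftSubgraph H) subcubic (connected z s z≢v s≢v) sz
... | inj₁ low = low
... | inj₂ ss with degAtMost2-or-saturated (liftSubgraph H) (subcubic s s≢v)
...   | inj₁ low = s , ss , low
...   | inj₂ sat = ⊥-elim (proj₂ (F⊆E H s t (sat t st)) deleted)

freeColour : (p q : Fin 3) → ∃ λ k → k ≢ p × k ≢ q
freeColour fzero fzero = fsuc fzero , (λ ()) , (λ ())
freeColour fzero (fsuc fzero) = fsuc (fsuc fzero) , (λ ()) , (λ ())
freeColour fzero (fsuc (fsuc fzero)) = fsuc fzero , (λ ()) , (λ ())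
freeColour (fsuc fzero) fzero = fsuc (fsuc fzero) , (λ ()) , (λ ())
freeColour (fsuc fzero) (fsuc fzero) = fzero , (λ ()) , (λ ())
freeColour (fsuc fzero) (fsuc (fsuc fzero)) = fzero , (λ ()) , (λ ())
freeColour (fsuc (fsuc fzero)) fzero = fsuc fzero , (λ ()) , (λ ())
freeColour (fsuc (fsuc fzero)) (fsuc fzero) = fzero , (λ ()) , (λ ())
freeColour (fsuc (fsuc fzero)) (fsuc (fsuc fzero)) = fzero , (λ ()) , (λ ())

colour-avoiding : ∀ {A : Set} (col : A → Fin 3) (ns : List A) → length ns ≤ 2 →
  ∃ λ k → ∀ {y} → y ∈ ns → col y ≢ k
colour-avoiding col [] _ = fzero , λ ()
colour-avoiding col (p ∷ []) _ with freeColour (col p) (col p)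
... | k , k≢p , _ = k , λ { (here refl) p≡k → k≢p (sym p≡k) }
colour-avoiding col (p ∷ q ∷ []) _ with freeColour (col p) (col q)
... | k , k≢p , k≢q = k , λ { (here refl) p≡k → k≢p (sym p≡k) ; (there (here refl)) q≡k → k≢q (sym q≡k) }
colour-avoiding col (_ ∷ _ ∷ _ ∷ _) (s≤s (s≤s ()))

module _ {G : Graph} (fin : IsFiniteSimple G) where

  open IsFiniteSimple fin
  open DecMembership _≟_ using (_∈?_)

  induced : List (V G) → Subgraph G
  induced xs = record
    { S    = λ x → ⌊ x ∈? xs ⌋
    ; F    = λ x y → ⌊ x ∈? xs ×-dec y ∈? xs ×-dec adj? x y ⌋
    ; F⊆E  = λ x y f → proj₂ (proj₂ (toWitness f))
    ; F⊆S  = λ x y f → fromWitness (proj₁ (toWitness f)) , fromWitness (proj₁ (proj₂ (toWitness f)))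
    ; Fsym = λ x y f → let x∈ , y∈ , xy = toWitness f in fromWitness (y∈ , x∈ , adj-sym xy)
    }

  ProperOn : List (V G) → (V G → Fin 3) → Set
  ProperOn xs col = ∀ {x y} → x ∈ xs → y ∈ xs → Adj G x y → col x ≢ col y

  colourable : TwoDegenerate G → ∀ n xs → length xs ≤ n → Σ (V G → Fin 3) (ProperOn xs)
  colourable twoDeg n [] _ = (λ _ → fzero) , λ ()
  colourable twoDeg (suc n) xs@(x₀ ∷ _) |xs|≤1+n
    with twoDeg (induced xs) (x₀ , fromWitness (here refl))
  ... | x , sx , ns , |ns|≤2 , ns-covers = colour , proper
    where
    x∈xs = toWitness sx
    ≢x? : ∀ y → Dec (y ≢ x)
    ≢x? y = ¬? (y ≟ x)
    rest = filter ≢x? xs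
    |rest|≤n : length rest ≤ n
    |rest|≤n = ≤-pred (<-≤-trans (filter-notAll ≢x? xs (lose x∈xs λ x≢x → x≢x refl)) |xs|≤1+n)
    col′ = proj₁ (colourable twoDeg n rest |rest|≤n)
    proper′ = proj₂ (colourable twoDeg n rest |rest|≤n)
    k = proj₁ (colour-avoiding col′ ns |ns|≤2)
    k-free = proj₂ (colour-avoiding col′ ns |ns|≤2)

    recolour : ∀ y → Dec (y ≡ x) → Fin 3
    recolour y (yes _) = k
    recolour y (no _) = col′ y
    colour : V G → Fin 3
    colour y = recolour y (y ≟ x)

    neighbour-colour : ∀ {y} → y ∈ xs → Adj G x y → col′ y ≢ k
    neighbour-colour y∈xs xy = k-free (ns-covers _ (fromWitness (x∈xs , y∈xs , xy)))

    proper : ProperOn xs colour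
    proper {y} {z} y∈xs z∈xs yz with y ≟ x | z ≟ x
    ... | yes refl | yes refl = λ _ → adj-irrefl yz
    ... | yes refl | no _ = λ k≡ → neighbour-colour z∈xs yz (sym k≡)
    ... | no _ | yes refl = neighbour-colour y∈xs (adj-sym yz)
    ... | no y≢x | no z≢x = proper′ (∈-filter⁺ ≢x? y∈xs y≢x) (∈-filter⁺ ≢x? z∈xs z≢x) yz

  twoDegenerate⇒threeColorable : TwoDegenerate G → ThreeColorable G
  twoDegenerate⇒threeColorable twoDeg =
    let col , proper = colourable twoDeg _ vertices ≤-refl
    in col , λ x y → proper (∈-vertices x) (∈-vertices y)

letters : List Letter
letters = a ∷ b ∷ c ∷ d ∷ e ∷ []

∈-letters : ∀ x → x ∈ letters
∈-letters a = here refl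
∈-letters b = there (here refl)
∈-letters c = there (there (here refl))
∈-letters d = there (there (there (here refl)))
∈-letters e = there (there (there (there (here refl))))

==L⇒≡ : ∀ x y → T (x ==L y) → x ≡ y
==L⇒≡ a = λ { a _ → refl ; b () ; c () ; d () ; e () }
==L⇒≡ b = λ { a () ; b _ → refl ; c () ; d () ; e () }
==L⇒≡ c = λ { a () ; b () ; c _ → refl ; d () ; e () }
==L⇒≡ d = λ { a () ; b () ; c () ; d _ → refl ; e () }
==L⇒≡ e = λ { a () ; b () ; c () ; d () ; e _ → refl }

==L-refl : ∀ x → T (x ==L x)
==L-refl a = _
==L-refl b = _
==L-refl c = _
==L-refl d = _
==L-refl e = _

≢⇒not==L : ∀ x y → x ≢ y → T (not (x ==L y))
≢⇒not==L x y x≢y with x ==L y in x=y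
... | true = x≢y (==L⇒≡ x y (subst T (sym x=y) _))
... | false = _

not==L⇒≢ : ∀ x y → T (not (x ==L y)) → x ≢ y
not==L⇒≢ a _ () refl
not==L⇒≢ b _ () refl
not==L⇒≢ c _ () refl
not==L⇒≢ d _ () refl
not==L⇒≢ e _ () refl

_≟L_ : DecidableEquality Letter
x ≟L y = map′ (==L⇒≡ x y) (λ { refl → ==L-refl x }) (T? (x ==L y))

prevL : Letter → Letter
prevL a = e
prevL b = a
prevL c = b
prevL d = c
prevL e = d

prevL-nextL : ∀ x → prevL (nextL x) ≡ x
prevL-nextL a = refl
prevL-nextL b = refl
prevL-nextL c = refl
prevL-nextL d = refl
prevL-nextL e = refl

nextL-≢ : ∀ x → x ≢ nextL x
nextL-≢ a ()
nextL-≢ b ()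
nextL-≢ c ()
nextL-≢ d ()
nextL-≢ e ()

module _ {G : Graph} {P : V G → Set} (f : Letter → V G) (P-f : ∀ x → P (f x))
  (edge : ∀ x → Adj G (f x) (f (nextL x))) where

  private
    hop : ∀ x {z} → Walk G P (f (nextL x)) z → Walk G P (f x) z
    hop x = step (P-f x) (edge x)

  cycle-walk : ∀ x → Walk G P (f x) (f a)
  cycle-walk a = [ P-f a ]
  cycle-walk b = hop b (hop c (hop d (hop e [ P-f a ])))
  cycle-walk c = hop c (hop d (hop e [ P-f a ]))
  cycle-walk d = hop d (hop e [ P-f a ])
  cycle-walk e = hop e [ P-f a ]

==F⇒≡ : ∀ {n} (i j : Fin n) → T (i ==F j) → i ≡ j
==F⇒≡ i j i=j = toℕ-injective (≡ᵇ⇒≡ (toℕ i) (toℕ j) i=j)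

==F-refl : ∀ {n} (i : Fin n) → T (i ==F i)
==F-refl i = ≡⇒≡ᵇ (toℕ i) (toℕ i) refl

isLeaf-c : ∀ m n → T (isLeaf m n c) → n ≡ m
isLeaf-c m (suc k) leaf-c with suc k ≡ᵇ m in eq
... | true = ≡ᵇ⇒≡ (suc k) m (subst T (sym eq) _)

¬isLeaf-suc-a : ∀ m k → ¬ T (isLeaf m (suc k) a)
¬isLeaf-suc-a m k leaf-a with suc k ≡ᵇ m
... | true = leaf-a
... | false = leaf-a

module _ {m : ℕ} where

  leaf-cong : ∀ {i j : Fin (suc m)} {x y Y Z} {p q} → i ≡ j → x ≡ y → Y ≡ Z →
    leaf {m} i x p Y ≡ leaf j y q Z
  leaf-cong {i} {x = x} {Y = Y} refl refl refl = cong (λ p → leaf i x p Y) (T-irrelevant _ _)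

  data Arc : Vtx m → Vtx m → Set where
    spine-cycle : ∀ i x → Arc (spine i x) (spine i (nextL x))
    spine-link  : ∀ {i j} → suc (toℕ i) ≡ toℕ j → Arc (spine i c) (spine j a)
    leg         : ∀ i x p → Arc (spine i x) (leaf i x p x)
    leaf-cycle  : ∀ i x p q Y → Arc (leaf i x p Y) (leaf i x q (nextL Y))
    spoke       : ∀ i x p Y → Y ≢ x → Arc apex (leaf i x p Y)

  arc⇒Arc : ∀ u w → T (arc u w) → Arc u w
  arc⇒Arc (spine i x) (spine j y) uw with to T-∨ uw
  ... | inj₁ cyc with i=j , y=x⁺ ← to T-∧ cyc
    with refl ← ==F⇒≡ i j i=j | refl ← ==L⇒≡ y (nextL x) y=x⁺
    = spine-cycle i x
  ... | inj₂ link with x=c , rest ← to (T-∧ {x ==L c}) link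
    with y=a , i⁺=j ← to (T-∧ {y ==L a}) rest
    with refl ← ==L⇒≡ x c x=c | refl ← ==L⇒≡ y a y=a
    = spine-link (≡ᵇ⇒≡ _ _ i⁺=j)
  arc⇒Arc (spine i x) (leaf j y q Y) uw with i=j , rest ← to T-∧ uw
    with x=y , Y=x ← to (T-∧ {x ==L y}) rest
    with refl ← ==F⇒≡ i j i=j | refl ← ==L⇒≡ x y x=y | refl ← ==L⇒≡ Y x Y=x
    = leg i x q
  arc⇒Arc (leaf i x p Y) (leaf j y q Z) uw with i=j , rest ← to T-∧ uw
    with x=y , Z=Y⁺ ← to (T-∧ {x ==L y}) rest
    with refl ← ==F⇒≡ i j i=j | refl ← ==L⇒≡ x y x=y | refl ← ==L⇒≡ Z (nextL Y) Z=Y⁺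
    = leaf-cycle i x p q Y
  arc⇒Arc apex (leaf i x p Y) uw = spoke i x p Y (not==L⇒≢ Y x uw)

  Arc⇒arc : ∀ {u w} → Arc u w → T (arc u w)
  Arc⇒arc (spine-cycle i x) = from T-∨ (inj₁ (from T-∧ (==F-refl i , ==L-refl (nextL x))))
  Arc⇒arc (spine-link i⁺=j) = from T-∨ (inj₂ (≡⇒≡ᵇ _ _ i⁺=j))
  Arc⇒arc (leg i x p) = from T-∧ (==F-refl i , from T-∧ (==L-refl x , ==L-refl x))
  Arc⇒arc (leaf-cycle i x p q Y) = from T-∧ (==F-refl i , from T-∧ (==L-refl x , ==L-refl (nextL Y)))
  Arc⇒arc (spoke i x p Y Y≢x) = ≢⇒not==L Y x Y≢x

  Arc-irrefl : ∀ {u w} → Arc u w → u ≢ w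
  Arc-irrefl (spine-cycle i x) eq = nextL-≢ x (cong (λ { (spine _ y) → y ; _ → x }) eq)
  Arc-irrefl (leaf-cycle i x p q Y) eq = nextL-≢ Y (cong (λ { (leaf _ _ _ Z) → Z ; _ → Y }) eq)

  adj⇒Arc : ∀ {u w : Vtx m} → T (adj u w) → Arc u w ⊎ Arc w u
  adj⇒Arc {u} {w} uw = Sum.map (arc⇒Arc u w) (arc⇒Arc w u) (to T-∨ uw)

  Arc⇒adj : ∀ {u w} → Arc u w → T (adj u w)
  Arc⇒adj uw = from T-∨ (inj₁ (Arc⇒arc uw))

  Arc⇒adj⁻ : ∀ {u w} → Arc u w → T (adj w u)
  Arc⇒adj⁻ uw = from T-∨ (inj₂ (Arc⇒arc uw))

  adj-symmetric : ∀ {u w : Vtx m} → T (adj u w) → T (adj w u)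
  adj-symmetric {u} {w} uw = from (T-∨ {arc w u}) (Sum.swap (to (T-∨ {arc u w}) uw))

  adj-irreflexive : ∀ {u : Vtx m} → ¬ T (adj u u)
  adj-irreflexive {u} uu with adj⇒Arc {u} {u} uu
  ... | inj₁ uu′ = Arc-irrefl uu′ refl
  ... | inj₂ uu′ = Arc-irrefl uu′ refl

  _≟V_ : DecidableEquality (Vtx m)
  spine i x ≟V spine j y =
    map′ (λ (i≡j , x≡y) → cong₂ spine i≡j x≡y) (λ { refl → refl , refl }) (i ≟F j ×-dec x ≟L y)
  leaf i x p Y ≟V leaf j y q Z =
    map′ (λ (i≡j , x≡y , Y≡Z) → leaf-cong i≡j x≡y Y≡Z) (λ { refl → refl , refl , refl })
         (i ≟F j ×-dec x ≟L y ×-dec Y ≟L Z)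
  apex ≟V apex = yes refl
  spine _ _ ≟V leaf _ _ _ _ = no λ ()
  spine _ _ ≟V apex = no λ ()
  leaf _ _ _ _ ≟V spine _ _ = no λ ()
  leaf _ _ _ _ ≟V apex = no λ ()
  apex ≟V spine _ _ = no λ ()
  apex ≟V leaf _ _ _ _ = no λ ()

  leafBlock : ∀ i x → Dec (T (isLeaf m (toℕ i) x)) → List (Vtx m)
  leafBlock i x (yes p) = map (leaf i x p) letters
  leafBlock i x (no _) = []

  ∈-leafBlock : ∀ i x p Y (p? : Dec (T (isLeaf m (toℕ i) x))) → leaf i x p Y ∈ leafBlock i x p?
  ∈-leafBlock i x p Y (yes q) =
    subst (_∈ map (leaf i x q) letters) (leaf-cong refl refl refl) (∈-map⁺ (leaf i x q) (∈-letters Y))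
  ∈-leafBlock i x p Y (no ¬p) = ⊥-elim (¬p p)

  blockAt : Fin (suc m) → Letter → List (Vtx m)
  blockAt i x = spine i x ∷ leafBlock i x (T? (isLeaf m (toℕ i) x))

  block : Fin (suc m) → List (Vtx m)
  block i = concatMap (blockAt i) letters

  allVertices : List (Vtx m)
  allVertices = apex ∷ concatMap block (allFin (suc m))

  ∈-allVertices : ∀ z → z ∈ allVertices
  ∈-allVertices apex = here refl
  ∈-allVertices (spine i x) =
    there (∈-concatMap block (∈-allFin i) (∈-concatMap (blockAt i) (∈-letters x) (here refl)))
  ∈-allVertices (leaf i x p Y) =
    there (∈-concatMap block (∈-allFin i) (∈-concatMap (blockAt i) (∈-letters x)
      (there (∈-leafBlock i x p Y (T? (isLeaf m (toℕ i) x))))))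

G-isFiniteSimple : ∀ m → IsFiniteSimple (G m)
G-isFiniteSimple m = record
  { _≟_        = _≟V_
  ; adj?       = λ u w → T? (adj u w)
  ; adj-sym    = λ {u} {w} → adj-symmetric {u = u} {w}
  ; adj-irrefl = λ {u} → adj-irreflexive {u = u}
  ; vertices   = allVertices
  ; ∈-vertices = ∈-allVertices
  }

module _ {m : ℕ} where

  data SpineExit (i : Fin (suc m)) : Letter → Vtx m → Set where
    leg       : ∀ {x} p → SpineExit i x (leaf i x p x)
    link-next : ∀ {j} → suc (toℕ i) ≡ toℕ j → SpineExit i c (spine j a)
    link-prev : ∀ {j} → suc (toℕ j) ≡ toℕ i → SpineExit i a (spine j c)

  spine-neighbour : ∀ {i x y} → Arc (spine i x) y ⊎ Arc y (spine i x) →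
    y ≡ spine i (nextL x) ⊎ y ≡ spine i (prevL x) ⊎ SpineExit i x y
  spine-neighbour (inj₁ (spine-cycle i x)) = inj₁ refl
  spine-neighbour (inj₁ (spine-link i⁺≡j)) = inj₂ (inj₂ (link-next i⁺≡j))
  spine-neighbour (inj₁ (leg i x p)) = inj₂ (inj₂ (leg p))
  spine-neighbour (inj₂ (spine-cycle i x)) = inj₂ (inj₁ (cong (spine i) (sym (prevL-nextL x))))
  spine-neighbour (inj₂ (spine-link j⁺≡i)) = inj₂ (inj₂ (link-prev j⁺≡i))

  -- S_i[c] carries a leaf only for i = m, and S_i[a] only for i = 0, exactly where
  -- the spine has no link to continue along.
  leg-unique : ∀ {i x y} (p : T (isLeaf m (toℕ i) x)) → SpineExit i x y → y ≡ leaf i x p x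
  leg-unique p (leg q) = leaf-cong refl refl refl
  leg-unique {i} p (link-next {j} i⁺≡j) =
    ⊥-elim (<-irrefl (trans (sym i⁺≡j) (cong suc (isLeaf-c m (toℕ i) p))) (toℕ<n j))
  leg-unique p (link-prev {j} j⁺≡i) =
    ⊥-elim (¬isLeaf-suc-a m (toℕ j) (subst (λ n → T (isLeaf m n a)) (sym j⁺≡i) p))

  spineExit-unique : ∀ {i x y y′} → SpineExit i x y → SpineExit i x y′ → y ≡ y′
  spineExit-unique (leg p) exit′ = sym (leg-unique p exit′)
  spineExit-unique exit (leg p) = leg-unique p exit
  spineExit-unique (link-next i⁺≡j) (link-next i⁺≡j′) =
    cong (λ j → spine j a) (toℕ-injective (trans (sym i⁺≡j) i⁺≡j′))
  spineExit-unique (link-prev j⁺≡i) (link-prev j′⁺≡i) =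
    cong (λ j → spine j c) (toℕ-injective (suc-injective (trans j⁺≡i (sym j′⁺≡i))))

  LeafExit : Fin (suc m) → Letter → Letter → Vtx m → Set
  LeafExit i x Y y = (Y ≡ x × y ≡ spine i x) ⊎ (Y ≢ x × y ≡ apex)

  leaf-neighbour : ∀ {i x p Y y} → Arc (leaf i x p Y) y ⊎ Arc y (leaf i x p Y) →
    y ≡ leaf i x p (nextL Y) ⊎ y ≡ leaf i x p (prevL Y) ⊎ LeafExit i x Y y
  leaf-neighbour (inj₁ (leaf-cycle i x p q Y)) = inj₁ (leaf-cong refl refl refl)
  leaf-neighbour (inj₂ (leg i x p)) = inj₂ (inj₂ (inj₁ (refl , refl)))
  leaf-neighbour (inj₂ (leaf-cycle i x p q Y)) = inj₂ (inj₁ (leaf-cong refl refl (sym (prevL-nextL Y))))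
  leaf-neighbour (inj₂ (spoke i x p Y Y≢x)) = inj₂ (inj₂ (inj₂ (Y≢x , refl)))

  leafExit-unique : ∀ {i x Y y y′} → LeafExit i x Y y → LeafExit i x Y y′ → y ≡ y′
  leafExit-unique (inj₁ (_ , refl)) (inj₁ (_ , refl)) = refl
  leafExit-unique (inj₁ (Y≡x , _)) (inj₂ (Y≢x , _)) = ⊥-elim (Y≢x Y≡x)
  leafExit-unique (inj₂ (Y≢x , _)) (inj₁ (Y≡x , _)) = ⊥-elim (Y≢x Y≡x)
  leafExit-unique (inj₂ (_ , refl)) (inj₂ (_ , refl)) = refl

  offApex-degree≤3 : ∀ (z : Vtx m) → z ≢ apex → DegreeAtMost (G m) 3 z
  offApex-degree≤3 (spine i x) _ =
    degree≤3 (G-isFiniteSimple m) (spine i x) (spine i (nextL x)) (spine i (prevL x)) (SpineExit i x)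
      (λ xy → spine-neighbour (adj⇒Arc xy)) spineExit-unique
  offApex-degree≤3 (leaf i x p Y) _ =
    degree≤3 (G-isFiniteSimple m) (leaf i x p Y) (leaf i x p (nextL Y)) (leaf i x p (prevL Y)) (LeafExit i x Y)
      (λ xy → leaf-neighbour (adj⇒Arc xy)) leafExit-unique
  offApex-degree≤3 apex apex≢apex = ⊥-elim (apex≢apex refl)

  ApexFreeWalk : Vtx m → Vtx m → Set
  ApexFreeWalk = Walk (G m) (_≢ apex)

  reverse-walk : ∀ {y z} → ApexFreeWalk y z → ApexFreeWalk z y
  reverse-walk = reverseʷ (λ {u} {w} → adj-symmetric {u = u} {w})

  root : Vtx m
  root = spine fzero a

  spine-cycle-walk : ∀ i x → ApexFreeWalk (spine i x) (spine i a)
  spine-cycle-walk i = cycle-walk (spine i) (λ _ ()) (λ x → Arc⇒adj (spine-cycle i x))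

  leaf-cycle-walk : ∀ i x p Y → ApexFreeWalk (leaf i x p Y) (leaf i x p a)
  leaf-cycle-walk i x p = cycle-walk (leaf i x p) (λ _ ()) (λ Y → Arc⇒adj (leaf-cycle i x p p Y))

  spine-a-walk-to-root : ∀ i → ApexFreeWalk (spine i a) root
  spine-a-walk-to-root = <-weakInduction (λ i → ApexFreeWalk (spine i a) root) [ (λ ()) ]
    λ k walk → step (λ ()) (Arc⇒adj⁻ (spine-link (cong suc (toℕ-inject₁ k))))
                    (spine-cycle-walk (inject₁ k) c ++ʷ walk)

  walk-to-root : ∀ z → z ≢ apex → ApexFreeWalk z root
  walk-to-root (spine i x) _ = spine-cycle-walk i x ++ʷ spine-a-walk-to-root i
  walk-to-root (leaf i x p Y) _ =
    leaf-cycle-walk i x p Y ++ʷ (reverse-walk (leaf-cycle-walk i x p x) ++ʷ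
      step (λ ()) (Arc⇒adj⁻ (leg i x p)) (walk-to-root (spine i x) (λ ())))
  walk-to-root apex apex≢apex = ⊥-elim (apex≢apex refl)

  apexFree-connected : ∀ y z → y ≢ apex → z ≢ apex → ApexFreeWalk y z
  apexFree-connected y z y≢apex z≢apex = walk-to-root y y≢apex ++ʷ reverse-walk (walk-to-root z z≢apex)

proposition4p6 : (m : ℕ) → 1 ≤ m → (u w : V (G m)) → Adj (G m) u w →
    TwoDegenerate (deleteEdge (G m) u w) × ThreeColorable (deleteEdge (G m) u w)
proposition4p6 m _ u w uw =
  twoDegenerate ,
  twoDegenerate⇒threeColorable (deleteEdge-isFiniteSimple (G-isFiniteSimple m) u w) twoDegenerate
  where
  twoDegenerate : TwoDegenerate (deleteEdge (G m) u w)
  twoDegenerate = deleteEdge-twoDegenerate (G-isFiniteSimple m) apex offApex-degree≤3 apexFree-connected uw
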